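{- Let $n \geq 2$ be an integer and let \[ G = \Big\{2^{n-1},\ 2^{n-1} + 2^{n-2},\ \ldots,\ \sum_{i=1}^{n}2^{n-i}\Big\} = \Big\{\sum_{i=1}^{b} 2^{n-i} : 1 \le b \le n\Big\}. \] Let $l$ be a non-decreasing integer-valued sequence with $l(1) = 2^{n-1}$ and $l(k+1) - l(k) \in G$ for all $k \ge 1$. Set $D_1 = \{l(k)\}_{k=1}^{\infty}$ and \[ D_2 = D_1 \pm 2^{n-2},\quad D_3 = D_1 \pm 2^{n-2} \pm 2^{n-3},\quad \ldots,\quad D_n = D_1 \pm 2^{n-2} \pm 2^{n-3} \pm \cdots \pm 2 \pm 1 . \] Then $D_1, D_2, \ldots, D_n$ are pairwise disjoint and their union is the set of all positive integers.
   Context: For a set $S$ of real numbers and a real number $r$, $S \pm r = \{s + r : s \in S\} \cup \{s - r : s \in S\}$, and iteratively $S \pm r_1 \pm \cdots \pm r_m = (S \pm r_1 \pm \cdots \pm r_{m-1}) \pm r_m$. -}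

module Defs where

open import Data.Nat using (ℕ; zero; suc; _∸_; _^_; _≤_)
open import Data.Integer using (ℤ; +_; _+_; _-_)
open import Data.Sum using (_⊎_)
open import Data.Product using (∃-syntax; _×_)
open import Relation.Binary.PropositionalEquality using (_≡_)

ℤSet : Set₁
ℤSet = ℤ → Set

_±_ : ℤSet → ℤ → ℤSet
(S ± r) x = S (x - r) ⊎ S (x + r)

partialSum : ℕ → ℕ → ℕ
partialSum n zero = zero
partialSum n (suc b) = partialSum n b Data.Nat.+ 2 ^ (n ∸ suc b)

G : ℕ → ℤSet
G n g = ∃[ b ] (1 ≤ b × b ≤ n × g ≡ + partialSum n b)

D₁ : (ℕ → ℤ) → ℤSet
D₁ l x = ∃[ k ] (1 ≤ k × l k ≡ x)

-- iterated: pmIter n S m = S ± 2^(n-2) ± 2^(n-3) ± ... ± 2^(n-1-m)   (m shifts)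
pmIter : ℕ → ℤSet → ℕ → ℤSet
pmIter n S zero = S
pmIter n S (suc m) = pmIter n S m ± (+ (2 ^ (n ∸ (2 Data.Nat.+ m))))

-- D n l j  =  D_j  for 1 ≤ j ≤ n  (D_j = D₁ ± 2^(n-2) ± ... ± 2^(n-j), i.e. j-1 shifts)
D : ℕ → (ℕ → ℤ) → ℕ → ℤSet
D n l j = pmIter n (D₁ l) (j ∸ 1)

module Submission where

-- Write h = 2^(n-1).  Unfolding the iterated ± shifts,
-- x lies in D_j (1 ≤ j ≤ n) exactly when x + h = l(k) + w for some k ≥ 1 and
-- some w with 0 < w < 2^n whose 2-adic valuation is n - j: the signed sums
-- ±2^(n-2) ± ... ± 2^(n-j), shifted by h, are precisely the odd multiples of
-- 2^(n-j) below 2^n.  Call l(k) + (0, 2^n) the k-th window.  Every gap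
-- l(k+1) - l(k) ∈ G has the form 2^n - 2^t with 2^t dividing it and is at least
-- h, so windows two apart do not meet, and on the overlap of adjacent windows
-- the two offsets differ by a multiple of 2^t, which preserves valuations
-- below t.  Hence the valuation of the offset of a point does not depend on the
-- window used, which gives disjointness; every integer above h = l(1) lies in
-- some window, which gives the covering; and points of a window exceed l(k) ≥ h,
-- which gives positivity.

open import Defs
open import Data.Nat using (ℕ; zero; suc; _+_; _*_; _∸_; _^_; _≤_; _<_; _≤′_; ≤′-reflexive; ≤′-step; z≤n; s≤s; z<s; _≤?_)
open import Data.Nat.Properties
open import Data.Nat.Divisibility using (_∣_; divides; ∣-refl; ∣-trans; ∣m∣n⇒∣m+n)
open import Data.Nat.Induction using (<-rec)
open import Data.Nat.Tactic.RingSolver using (solve-∀)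
open import Data.Integer using (ℤ; +_; ∣_∣; _-_; +<+) renaming (_+_ to _+ℤ_; _≤_ to _≤ℤ_; _<_ to _<ℤ_)
import Data.Integer.Properties as ℤ
import Data.Integer.Tactic.RingSolver as ℤRing
open import Data.Product using (∃-syntax; _×_; _,_; proj₂)
open import Data.Sum using (_⊎_; inj₁; inj₂)
open import Data.Sum.Function.Propositional using (_⊎-⇔_)
open import Data.Empty using (⊥-elim)
open import Function using (_∘_)
open import Function.Bundles using (_⇔_; mk⇔; Equivalence)
open import Function.Construct.Composition using (_⇔-∘_)
open import Relation.Binary.PropositionalEquality
open import Relation.Binary using (tri<; tri≈; tri>)
open import Relation.Nullary using (¬_; yes; no)

record Valuation (p w : ℕ) : Set where
  constructor odd-part
  field
    q     : ℕ
    shape : w ≡ 2 ^ p * suc (2 * q)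

even-or-odd : ∀ q → ∃[ a ] (q ≡ 2 * a ⊎ q ≡ suc (2 * a))
even-or-odd zero = 0 , inj₁ refl
even-or-odd (suc q) with even-or-odd q
... | a , inj₁ even = a , inj₂ (cong suc even)
... | a , inj₂ odd  = suc a , inj₁ (trans (cong suc odd) (sym (*-suc 2 a)))

odd-part-exponent : ∀ p p' q q' → 2 ^ p * suc (2 * q) ≡ 2 ^ p' * suc (2 * q') → p ≡ p'
odd-part-exponent zero zero _ _ _ = refl
odd-part-exponent zero (suc p') q q' e =
  ⊥-elim (even≢odd (2 ^ p' * suc (2 * q')) q
    (trans (sym (*-assoc 2 (2 ^ p') _)) (trans (sym e) (*-identityˡ _))))
odd-part-exponent (suc p) zero q q' e =
  ⊥-elim (even≢odd (2 ^ p * suc (2 * q)) q'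
    (trans (sym (*-assoc 2 (2 ^ p) _)) (trans e (*-identityˡ _))))
odd-part-exponent (suc p) (suc p') q q' e =
  cong suc (odd-part-exponent p p' q q'
    (*-cancelˡ-≡ _ _ 2 (trans (sym (*-assoc 2 (2 ^ p) _)) (trans e (*-assoc 2 (2 ^ p') _)))))

valuation-unique : ∀ {p p' w} → Valuation p w → Valuation p' w → p ≡ p'
valuation-unique {p} {p'} (odd-part q e) (odd-part q' e') =
  odd-part-exponent p p' q q' (trans (sym e) e')

valuation-exists : ∀ w → 0 < w → ∃[ p ] Valuation p w
valuation-exists = <-rec (λ w → 0 < w → ∃[ p ] Valuation p w) step
  where
  half< : ∀ a → 0 < a → a < 2 * a
  half< a a>0 = m<m+n a (subst (0 <_) (sym (+-identityʳ a)) a>0)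

  step : ∀ w → (∀ {v} → v < w → 0 < v → ∃[ p ] Valuation p v) →
         0 < w → ∃[ p ] Valuation p w
  step w rec w>0 with even-or-odd w
  ... | a , inj₂ odd = 0 , odd-part a (trans odd (sym (*-identityˡ _)))
  ... | zero , inj₁ refl = ⊥-elim (<-irrefl refl w>0)
  ... | suc a , inj₁ refl with rec (half< (suc a) z<s) z<s
  ...   | p , odd-part q e = suc p , odd-part q (trans (cong (2 *_) e) (sym (*-assoc 2 (2 ^ p) _)))

valuation-+-multiple : ∀ {p g w} → 2 ^ suc p ∣ g → Valuation p w → Valuation p (g + w)
valuation-+-multiple {p} (divides c refl) (odd-part q refl) = odd-part (q + c) (shape c (2 ^ p) q)
  where
  shape : ∀ c P q → c * (2 * P) + P * suc (2 * q) ≡ P * suc (2 * (q + c))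
  shape = solve-∀

valuation-≤ : ∀ {p w} → Valuation p w → 2 ^ p ≤ w
valuation-≤ {p} (odd-part q refl) = m≤m*n (2 ^ p) (suc (2 * q))

^-cancel-< : ∀ {a b} → 2 ^ a < 2 ^ b → a < b
^-cancel-< lt = ≰⇒> (λ b≤a → <⇒≱ lt (^-monoʳ-≤ 2 b≤a))

^-∣ : ∀ {a b} → a ≤ b → 2 ^ a ∣ 2 ^ b
^-∣ {a} {b} a≤b = divides (2 ^ (b ∸ a))
  (trans (cong (2 ^_) (sym (m∸n+n≡m a≤b))) (^-distribˡ-+-* 2 (b ∸ a) a))

odd-< : ∀ q m → (suc (2 * q) < 2 ^ suc m) ⇔ (q < 2 ^ m)
odd-< q m = mk⇔
  (λ lt → *-cancelˡ-≤ 2 (subst (_≤ 2 * 2 ^ m) (sym (*-suc 2 q)) lt))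
  (λ q< → subst (_≤ 2 * 2 ^ m) (*-suc 2 q) (*-monoʳ-≤ 2 q<))

odd-multiple-< : ∀ p m q → (2 ^ p * suc (2 * q) < 2 ^ (p + suc m)) ⇔ (q < 2 ^ m)
odd-multiple-< p m q = odd-< q m ⇔-∘ mk⇔
  (λ lt → *-cancelˡ-< (2 ^ p) _ _ (subst (_ <_) split lt))
  (λ lt → subst (_ <_) (sym split) (*-monoʳ-< (2 ^ p) {{m^n≢0 2 p}} lt))
  where
  split : 2 ^ (p + suc m) ≡ 2 ^ p * 2 ^ suc m
  split = ^-distribˡ-+-* 2 p (suc m)

∸-unfold : ∀ {n b} → b < n → n ∸ b ≡ suc (n ∸ suc b)
∸-unfold {suc n} {zero} _ = refl
∸-unfold {suc n} {suc b} (s≤s b<n) = ∸-unfold b<n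

∸-injective : ∀ {n i j} → i ≤ n → j ≤ n → n ∸ i ≡ n ∸ j → i ≡ j
∸-injective {n} i≤n j≤n e =
  trans (sym (m∸[m∸n]≡n i≤n)) (trans (cong (n ∸_) e) (m∸[m∸n]≡n j≤n))

crossing : ∀ (f : ℕ → ℕ) {N} d → f 0 < N → N ≤ f d → ∃[ a ] (f a < N × N ≤ f (suc a))
crossing f zero below above = ⊥-elim (<⇒≱ below above)
crossing f {N} (suc d) below above with N ≤? f 1
... | yes N≤f1 = 0 , below , N≤f1
... | no N≰f1 with crossing (f ∘ suc) d (≰⇒> N≰f1) above
...   | a , lo , hi = suc a , lo , hi

+ℤ-cancelʳ : ∀ x y c → x +ℤ c ≡ y +ℤ c → x ≡ y
+ℤ-cancelʳ x y c e = trans (undo x c) (trans (cong (_- c) e) (sym (undo y c)))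
  where
  undo : ∀ z c → z ≡ (z +ℤ c) - c
  undo = ℤRing.solve-∀

difference : ∀ a b c → a - b ≡ c → a ≡ b +ℤ c
difference a b c e = trans (split a b) (cong (b +ℤ_) e)
  where
  split : ∀ a b → a ≡ b +ℤ (a - b)
  split = ℤRing.solve-∀

translate : ∀ x r H s a → (x +ℤ H ≡ s +ℤ a) ⇔ ((x +ℤ r) +ℤ H ≡ s +ℤ (a +ℤ r))
translate x r H s a = mk⇔
  (λ e → trans (move x r H) (trans (cong (_+ℤ r) e) (ℤ.+-assoc s a r)))
  (λ e → +ℤ-cancelʳ _ _ r (trans (sym (move x r H)) (trans e (sym (ℤ.+-assoc s a r)))))
  where
  move : ∀ x r H → (x +ℤ r) +ℤ H ≡ (x +ℤ H) +ℤ r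
  move = ℤRing.solve-∀

translate⁻ : ∀ x r H s a → ((x - r) +ℤ H ≡ s +ℤ a) ⇔ (x +ℤ H ≡ s +ℤ (a +ℤ r))
translate⁻ x r H s a =
  subst (λ y → ((x - r) +ℤ H ≡ s +ℤ a) ⇔ (y +ℤ H ≡ s +ℤ (a +ℤ r)))
        (back x r) (translate (x - r) r H s a)
  where
  back : ∀ x r → (x - r) +ℤ r ≡ x
  back = ℤRing.solve-∀

module Windows (n : ℕ) (S : ℤSet) where

  -- The first shift 2^(n-1), by which every point is re-centred.
  H : ℤ
  H = + (2 ^ (n ∸ 1))

  -- x + H = s + 2^e(2q+1) with s ∈ S and q < 2^m: the set S shifted by all
  -- signed sums ±2^(e+m-1) ± ... ± 2^e, re-centred by H.
  Shifted : ℕ → ℕ → ℤ → Set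
  Shifted e m x = ∃[ s ] (S s × ∃[ q ] (q < 2 ^ m × x +ℤ H ≡ s +ℤ + (2 ^ e * suc (2 * q))))

  -- One more shift by ±2^e doubles the admissible odd parts: the minus side
  -- contributes the odd part 2q+1, the plus side the odd part 2q.
  Shifted-step : ∀ e m x →
    (Shifted (suc e) m (x - + 2 ^ e) ⊎ Shifted (suc e) m (x +ℤ + 2 ^ e)) ⇔ Shifted e (suc m) x
  Shifted-step e m x = mk⇔ to from
    where
    P : ℕ
    P = 2 ^ e

    odd-shape : ∀ P q → 2 * P * suc (2 * q) + P ≡ P * suc (2 * suc (2 * q))
    odd-shape = solve-∀
    even-shape : ∀ P q → 2 * P * suc (2 * q) ≡ P * suc (2 * (2 * q)) + P
    even-shape = solve-∀

    minus : ∀ s q → (x - + P) +ℤ H ≡ s +ℤ + (2 * P * suc (2 * q))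
                  → x +ℤ H ≡ s +ℤ + (P * suc (2 * suc (2 * q)))
    minus s q eq = subst (λ w → x +ℤ H ≡ s +ℤ + w) (odd-shape P q)
      (Equivalence.to (translate⁻ x (+ P) H s _) eq)

    plus : ∀ s q → (x +ℤ + P) +ℤ H ≡ s +ℤ + (2 * P * suc (2 * q))
                 → x +ℤ H ≡ s +ℤ + (P * suc (2 * (2 * q)))
    plus s q eq = Equivalence.from (translate x (+ P) H s _)
      (subst (λ w → (x +ℤ + P) +ℤ H ≡ s +ℤ + w) (even-shape P q) eq)

    to : Shifted (suc e) m (x - + P) ⊎ Shifted (suc e) m (x +ℤ + P) → Shifted e (suc m) x
    to (inj₁ (s , s∈ , q , q< , eq)) =
      s , s∈ , suc (2 * q) , Equivalence.from (odd-< q m) q< , minus s q eq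
    to (inj₂ (s , s∈ , q , q< , eq)) =
      s , s∈ , 2 * q , *-monoʳ-< 2 q< , plus s q eq

    from : Shifted e (suc m) x → Shifted (suc e) m (x - + P) ⊎ Shifted (suc e) m (x +ℤ + P)
    from (s , s∈ , q' , q'< , eq) with even-or-odd q'
    ... | a , inj₁ refl = inj₂ (s , s∈ , a , *-cancelˡ-< 2 a (2 ^ m) q'< ,
      subst (λ w → (x +ℤ + P) +ℤ H ≡ s +ℤ + w) (sym (even-shape P a))
        (Equivalence.to (translate x (+ P) H s _) eq))
    ... | a , inj₂ refl = inj₁ (s , s∈ , a , Equivalence.to (odd-< a m) q'< ,
      Equivalence.from (translate⁻ x (+ P) H s _)
        (subst (λ w → x +ℤ H ≡ s +ℤ + w) (sym (odd-shape P a)) eq))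

  pmIter⇔Shifted : ∀ m → m < n → ∀ x → pmIter n S m x ⇔ Shifted (n ∸ suc m) m x
  pmIter⇔Shifted zero _ x = mk⇔
    (λ s∈ → x , s∈ , 0 , s≤s z≤n , cong (λ w → x +ℤ + w) (sym (*-identityʳ _)))
    from
    where
    from : Shifted (n ∸ 1) 0 x → S x
    from (s , s∈ , zero , _ , eq) =
      subst S (+ℤ-cancelʳ s x H (sym (trans eq (cong (λ w → s +ℤ + w) (*-identityʳ _))))) s∈
    from (s , s∈ , suc q , s≤s () , eq)
  pmIter⇔Shifted (suc m) m+1<n x =
    Shifted-step (n ∸ suc (suc m)) m x ⇔-∘
      subst (λ e → pmIter n S (suc m) x ⇔ (Shifted e m (x - R) ⊎ Shifted e m (x +ℤ R)))
            (∸-unfold m+1<n)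
            (pmIter⇔Shifted m m<n (x - R) ⊎-⇔ pmIter⇔Shifted m m<n (x +ℤ R))
    where
    R : ℤ
    R = + 2 ^ (n ∸ suc (suc m))
    m<n : m < n
    m<n = <-trans (n<1+n m) m+1<n

  Window : ℕ → ℤ → Set
  Window p x = ∃[ s ] (S s × ∃[ w ] (w < 2 ^ n × Valuation p w × x +ℤ H ≡ s +ℤ + w))

  Shifted⇔Window : ∀ p m x → p + suc m ≡ n → Shifted p m x ⇔ Window p x
  Shifted⇔Window p m x p+m+1≡n = mk⇔
    (λ (s , s∈ , q , q< , eq) →
      s , s∈ , _ , bound (Equivalence.from (odd-multiple-< p m q) q<) , odd-part q refl , eq)
    (λ { (s , s∈ , w , w< , odd-part q refl , eq) →
      s , s∈ , q , Equivalence.to (odd-multiple-< p m q) (unbound w<) , eq })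
    where
    bound : ∀ {w} → w < 2 ^ (p + suc m) → w < 2 ^ n
    bound = subst (λ k → _ < 2 ^ k) p+m+1≡n
    unbound : ∀ {w} → w < 2 ^ n → w < 2 ^ (p + suc m)
    unbound = subst (λ k → _ < 2 ^ k) (sym p+m+1≡n)

  pmIter⇔Window : ∀ m → m < n → ∀ x → pmIter n S m x ⇔ Window (n ∸ suc m) x
  pmIter⇔Window m m<n x =
    Shifted⇔Window (n ∸ suc m) m x (m∸n+n≡m m<n) ⇔-∘ pmIter⇔Shifted m m<n x

IsGap : ℕ → ℕ → Set
IsGap n g = 2 ^ (n ∸ 1) ≤ g × ∃[ t ] (2 ^ t ∣ g × g + 2 ^ t ≡ 2 ^ n)

partialSum-complement : ∀ n b → b ≤ n → partialSum n b + 2 ^ (n ∸ b) ≡ 2 ^ n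
partialSum-complement n zero _ = refl
partialSum-complement n (suc b) b<n = begin
  partialSum n b + 2 ^ c + 2 ^ c    ≡⟨ +-assoc (partialSum n b) (2 ^ c) (2 ^ c) ⟩
  partialSum n b + (2 ^ c + 2 ^ c)  ≡⟨ cong (λ z → partialSum n b + z) doubling ⟩
  partialSum n b + 2 ^ (n ∸ b)      ≡⟨ partialSum-complement n b (<⇒≤ b<n) ⟩
  2 ^ n                             ∎
  where
  open ≡-Reasoning
  c : ℕ
  c = n ∸ suc b
  doubling : 2 ^ c + 2 ^ c ≡ 2 ^ (n ∸ b)
  doubling = trans (cong (λ z → (2 ^ c) + z) (sym (+-identityʳ _)))
                   (cong (2 ^_) (sym (∸-unfold b<n)))

partialSum-divisible : ∀ n b → 2 ^ (n ∸ b) ∣ partialSum n b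
partialSum-divisible n zero = divides 0 refl
partialSum-divisible n (suc b) = ∣m∣n⇒∣m+n
  (∣-trans (^-∣ (∸-monoʳ-≤ n (n≤1+n b))) (partialSum-divisible n b)) ∣-refl

partialSum-≥ : ∀ n b → 2 ^ (n ∸ 1) ≤ partialSum n (suc b)
partialSum-≥ n zero = ≤-refl
partialSum-≥ n (suc b) = ≤-trans (partialSum-≥ n b) (m≤m+n _ _)

G⇒IsGap : ∀ n b → 1 ≤ b → b ≤ n → IsGap n (partialSum n b)
G⇒IsGap n (suc b) _ b<n =
  partialSum-≥ n b , n ∸ suc b , partialSum-divisible n (suc b) , partialSum-complement n (suc b) b<n

module Staircase (n : ℕ) (n≥1 : 1 ≤ n) (L : ℕ → ℕ) (L0 : L 0 ≡ 2 ^ (n ∸ 1))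
                 (gap : ∀ k → ∃[ g ] (IsGap n g × L (suc k) ≡ L k + g)) where

  h : ℕ
  h = 2 ^ (n ∸ 1)

  -- Two minimal gaps make one window length (this is where n ≥ 1 is used).
  h+h : h + h ≡ 2 ^ n
  h+h = trans (cong (λ z → h + z) (sym (+-identityʳ h))) (cong (2 ^_) (sym (∸-unfold n≥1)))

  step-≥ : ∀ k → L k + h ≤ L (suc k)
  step-≥ k with gap k
  ... | g , (h≤g , _) , eq = subst (L k + h ≤_) (sym eq) (+-monoʳ-≤ (L k) h≤g)

  step-< : ∀ k → L (suc k) < L k + 2 ^ n
  step-< k with gap k
  ... | g , (_ , t , _ , g+2^t) , eq =
    subst₂ _<_ (sym eq) (cong (λ z → L k + z) g+2^t) (+-monoʳ-< (L k) (m<m+n g (m^n>0 2 t)))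

  L-mono : ∀ {a b} → a ≤ b → L a ≤ L b
  L-mono = mono ∘ ≤⇒≤′
    where
    mono : ∀ {a b} → a ≤′ b → L a ≤ L b
    mono (≤′-reflexive refl) = ≤-refl
    mono (≤′-step a≤′b) = ≤-trans (mono a≤′b) (≤-trans (m≤m+n _ h) (step-≥ _))

  L-≥h : ∀ k → h ≤ L k
  L-≥h k = subst (_≤ L k) L0 (L-mono z≤n)

  L-unbounded : ∀ k → k ≤ L k
  L-unbounded zero = z≤n
  L-unbounded (suc k) = ≤-trans
    (subst (_≤ L k + h) (+-comm k 1) (+-mono-≤ (L-unbounded k) (m^n>0 2 (n ∸ 1))))
    (step-≥ k)

  two-steps : ∀ a → L a + 2 ^ n ≤ L (suc (suc a))
  two-steps a = begin
    L a + 2 ^ n      ≡⟨ cong (λ z → L a + z) (sym h+h) ⟩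
    L a + (h + h)    ≡⟨ sym (+-assoc (L a) h h) ⟩
    L a + h + h      ≤⟨ +-monoˡ-≤ h (step-≥ a) ⟩
    L (suc a) + h    ≤⟨ step-≥ (suc a) ⟩
    L (suc (suc a))  ∎
    where open ≤-Reasoning

  -- On the overlap of adjacent windows the offsets differ by the gap
  -- g = 2^n - 2^t, a multiple of 2^t, while the later offset is below 2^t.
  adjacent : ∀ {a w w' p} → L a + w ≡ L (suc a) + w' → w < 2 ^ n →
             Valuation p w' → Valuation p w
  adjacent {a} {w} {w'} {p} e w< vw' with gap a
  ... | g , (_ , t , 2^t∣g , g+2^t) , eq =
    subst (Valuation p) (sym w≡g+w') (valuation-+-multiple (∣-trans (^-∣ p<t) 2^t∣g) vw')
    where
    w≡g+w' : w ≡ g + w'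
    w≡g+w' = +-cancelˡ-≡ (L a) _ _ (trans e (trans (cong (_+ w') eq) (+-assoc (L a) g w')))
    w'<2^t : w' < 2 ^ t
    w'<2^t = +-cancelˡ-< g _ _ (subst₂ _<_ w≡g+w' (sym g+2^t) w<)
    p<t : p < t
    p<t = ^-cancel-< (≤-<-trans (valuation-≤ vw') w'<2^t)

  far : ∀ {a b w w'} → suc (suc a) ≤ b → L a + w ≡ L b + w' → ¬ (w < 2 ^ n)
  far {a} {b} {w} {w'} a+2≤b e w< = <⇒≱ (+-monoʳ-< (L a) w<) (begin
    L a + 2 ^ n      ≤⟨ two-steps a ⟩
    L (suc (suc a))  ≤⟨ L-mono a+2≤b ⟩
    L b              ≤⟨ m≤m+n (L b) w' ⟩
    L b + w'         ≡⟨ sym e ⟩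
    L a + w          ∎)
    where open ≤-Reasoning

  ordered : ∀ {a b w w' p p'} → a < b → L a + w ≡ L b + w' → w < 2 ^ n →
            Valuation p w → Valuation p' w' → p ≡ p'
  ordered a<b e w< vw vw' with m≤n⇒m<n∨m≡n a<b
  ... | inj₁ a+1<b = ⊥-elim (far a+1<b e w<)
  ... | inj₂ refl = valuation-unique vw (adjacent e w< vw')

  offset-valuation : ∀ {a b w w' p p'} → L a + w ≡ L b + w' → w < 2 ^ n → w' < 2 ^ n →
                     Valuation p w → Valuation p' w' → p ≡ p'
  offset-valuation {a} {b} e w< w'< vw vw' with <-cmp a b
  ... | tri< a<b _ _ = ordered a<b e w< vw vw'
  ... | tri≈ _ refl _ =
    valuation-unique vw (subst (Valuation _) (sym (+-cancelˡ-≡ (L a) _ _ e)) vw')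
  ... | tri> _ _ b<a = sym (ordered b<a (sym e) w'< vw' vw)

  in-window : ∀ N → h < N → ∃[ a ] ∃[ w ] (0 < w × w < 2 ^ n × L a + w ≡ N)
  in-window N h<N with crossing L N (subst (_< N) (sym L0) h<N) (L-unbounded N)
  ... | a , below , above = a , N ∸ L a , m<n⇒0<n∸m below , offset< , m+[n∸m]≡n (<⇒≤ below)
    where
    offset< : N ∸ L a < 2 ^ n
    offset< = +-cancelˡ-< (L a) _ _
      (subst (_< L a + 2 ^ n) (sym (m+[n∸m]≡n (<⇒≤ below))) (≤-<-trans above (step-< a)))

-- The hypotheses of the theorem; l is recast as the natural sequence L k = l(k+1).
module Layers (n : ℕ) (n≥2 : 2 ≤ n) (l : ℕ → ℤ) (l1 : l 1 ≡ + (2 ^ (n ∸ 1)))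
              (stepG : ∀ k → 1 ≤ k → G n (l (suc k) - l k)) where

  l-step : ∀ k → ∃[ g ] (IsGap n g × l (suc (suc k)) ≡ l (suc k) +ℤ + g)
  l-step k with stepG (suc k) (s≤s z≤n)
  ... | b , 1≤b , b≤n , eq = partialSum n b , G⇒IsGap n b 1≤b b≤n , difference _ _ _ eq

  l-natural : ∀ k → ∃[ c ] (l (suc k) ≡ + c)
  l-natural zero = _ , l1
  l-natural (suc k) with l-natural k | l-step k
  ... | c , lc | g , _ , eq = c + g , trans eq (cong (_+ℤ + g) lc)

  L : ℕ → ℕ
  L k = ∣ l (suc k) ∣

  l≡L : ∀ k → l (suc k) ≡ + L k
  l≡L k with l-natural k
  ... | c , eq rewrite eq = refl

  L-gap : ∀ k → ∃[ g ] (IsGap n g × L (suc k) ≡ L k + g)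
  L-gap k with l-step k
  ... | g , isGap , eq =
    g , isGap , ℤ.+-injective (trans (sym (l≡L (suc k))) (trans eq (cong (_+ℤ + g) (l≡L k))))

  open Staircase n (≤-trans (s≤s z≤n) n≥2) L (ℤ.+-injective (trans (sym (l≡L 0)) l1)) L-gap
  open Windows n (D₁ l)

  D⇔Window : ∀ j → 1 ≤ j → j ≤ n → ∀ x → D n l j x ⇔ Window (n ∸ j) x
  D⇔Window (suc m) _ j≤n x = pmIter⇔Window m j≤n x

  offset : ∀ x {s w} → D₁ l s → x +ℤ H ≡ s +ℤ + w → ∃[ a ] (x +ℤ H ≡ + (L a + w))
  offset x (suc a , _ , refl) eq = a , trans eq (cong (_+ℤ + _) (l≡L a))

  disjoint : ∀ i j → 1 ≤ i → i ≤ n → 1 ≤ j → j ≤ n → ¬ (i ≡ j) →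
             ∀ x → ¬ (D n l i x × D n l j x)
  disjoint i j 1≤i i≤n 1≤j j≤n i≢j x (x∈Di , x∈Dj)
    with Equivalence.to (D⇔Window i 1≤i i≤n x) x∈Di
       | Equivalence.to (D⇔Window j 1≤j j≤n x) x∈Dj
  ... | s , s∈ , w , w< , vw , eq | s' , s'∈ , w' , w'< , vw' , eq'
    with offset x s∈ eq | offset x s'∈ eq'
  ... | a , ea | b , eb = i≢j (∸-injective i≤n j≤n
    (offset-valuation (ℤ.+-injective (trans (sym ea) eb)) w< w'< vw vw'))

  -- x + h = L a + w with L a ≥ h and w > 0 gives x > 0.
  positive : ∀ x → ∃[ j ] (1 ≤ j × j ≤ n × D n l j x) → + 0 <ℤ x
  positive x (j , 1≤j , j≤n , x∈Dj) with Equivalence.to (D⇔Window j 1≤j j≤n x) x∈Dj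
  ... | s , s∈ , w , _ , vw , eq with offset x s∈ eq
  ... | a , ea = subst (+ 0 <ℤ_) (sym x≡c+w) (+<+ (≤-trans w>0 (m≤n+m w c)))
    where
    c : ℕ
    c = L a ∸ h
    w>0 : 0 < w
    w>0 = ≤-trans (m^n>0 2 (n ∸ j)) (valuation-≤ vw)
    regroup : ∀ c h w → (c + h) + w ≡ (c + w) + h
    regroup = solve-∀
    x≡c+w : x ≡ + (c + w)
    x≡c+w = +ℤ-cancelʳ x (+ (c + w)) H
      (trans ea (cong +_ (trans (cong (_+ w) (sym (m∸n+n≡m (L-≥h a)))) (regroup c h w))))

  in-layer : ∀ {x a w p} → w < 2 ^ n → Valuation p w → x +ℤ H ≡ + (L a + w) →
             ∃[ j ] (1 ≤ j × j ≤ n × D n l j x)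
  in-layer {x} {a} {w} {p} w< vw eq = n ∸ p , 1≤j , j≤n ,
    Equivalence.from (D⇔Window (n ∸ p) 1≤j j≤n x)
      (l (suc a) , (suc a , s≤s z≤n , refl) , w , w< ,
       subst (λ q → Valuation q w) (sym (m∸[m∸n]≡n (<⇒≤ p<n))) vw ,
       trans eq (cong (_+ℤ + w) (sym (l≡L a))))
    where
    p<n : p < n
    p<n = ^-cancel-< (≤-<-trans (valuation-≤ vw) w<)
    1≤j : 1 ≤ n ∸ p
    1≤j = m<n⇒0<n∸m p<n
    j≤n : n ∸ p ≤ n
    j≤n = m∸n≤m n p

  -- A positive x puts x + h in some window, and its offset has some valuation.
  covered : ∀ x → + 0 <ℤ x → ∃[ j ] (1 ≤ j × j ≤ n × D n l j x)
  covered (+ X) (+<+ X>0) = from-window (in-window (X + h) (m<n+m h X>0))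
    where
    from-window : ∃[ a ] ∃[ w ] (0 < w × w < 2 ^ n × L a + w ≡ X + h) →
                  ∃[ j ] (1 ≤ j × j ≤ n × D n l j (+ X))
    from-window (a , w , w>0 , w< , e) =
      in-layer {a = a} w< (proj₂ (valuation-exists w w>0)) (cong +_ (sym e))

theorem2p2 : (n : ℕ) → 2 ≤ n → (l : ℕ → ℤ) →
    (∀ k → 1 ≤ k → l k ≤ℤ l (suc k)) →
    l 1 ≡ + (2 ^ (n ∸ 1)) →
    (∀ k → 1 ≤ k → G n (l (suc k) - l k)) →
    (∀ i j → 1 ≤ i → i ≤ n → 1 ≤ j → j ≤ n → ¬ (i ≡ j) →
      ∀ x → ¬ (D n l i x × D n l j x))
    × (∀ x → (+ 0 <ℤ x) ⇔ (∃[ j ] (1 ≤ j × j ≤ n × D n l j x)))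
theorem2p2 n n≥2 l _ l1 stepG = disjoint , λ x → mk⇔ (covered x) (positive x)
  where open Layers n n≥2 l l1 stepG
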